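{- Let $G$ and $H$ be connected graphs, each with at least two vertices. Then the visibility polynomial $\mathcal{V}(G\odot H)$ is a monic polynomial.
   Context: All graphs are finite, simple, undirected and connected. For a graph $G$ and $X \subseteq V(G)$, two vertices $u,v$ are $X$-visible if there exists a shortest $(u,v)$-path $P$ in $G$ with $V(P)\cap X \subseteq \{u,v\}$. A set $X\subseteq V(G)$ is a mutual-visibility set of $G$ if every two vertices of $X$ are $X$-visible (the empty set counts). The visibility polynomial of $G$ is $\mathcal{V}(G)=\sum_{i\ge 0} r_i x^i$, where $r_i$ is the number of mutual-visibility sets of $G$ of cardinality $i$. The corona $G\odot H$ is obtained from one copy of $G$ and $|V(G)|$ copies of $H$, the copy associated with $v\in V(G)$ being denoted $H_v$, by joining each $v \in V(G)$ to every vertex of $H_v$. -}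

module Defs where

open import Data.Nat using (ℕ; zero; suc; _+_; _*_; _≤_; _<_)
open import Data.Bool using (Bool; true; false; _∧_)
open import Data.Fin using (Fin; zero; suc; splitAt; quotRem; inject₁; fromℕ)
open import Data.Fin.Subset using (Subset; _∈_; ∣_∣)
open import Data.Fin.Properties using (_≟_)
open import Data.Sum using (_⊎_; inj₁; inj₂)
open import Data.Product using (Σ; _×_; _,_; ∃)
open import Data.List using (List; length)
open import Data.List.Relation.Unary.Unique.Propositional using (Unique)
import Data.List.Membership.Propositional as LMem
open import Function.Bundles using (_⇔_)
open import Relation.Binary.PropositionalEquality using (_≡_; _≢_)
open import Relation.Nullary.Decidable using (⌊_⌋)

record Graph : Set where
  field
    n   : ℕ
    adj : Fin n → Fin n → Bool
open Graph public

IsSimple : Graph → Set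
IsSimple G = (∀ u v → adj G u v ≡ adj G v u) × (∀ v → adj G v v ≡ false)

record Walk (G : Graph) (u v : Fin (n G)) (k : ℕ) : Set where
  field
    vert  : Fin (suc k) → Fin (n G)
    start : vert zero ≡ u
    end   : vert (fromℕ k) ≡ v
    step  : ∀ (i : Fin k) → adj G (vert (inject₁ i)) (vert (suc i)) ≡ true
open Walk public

Connected : Graph → Set
Connected G = ∀ u v → ∃ λ k → Walk G u v k

record ShortestPath (G : Graph) (u v : Fin (n G)) : Set where
  field
    len      : ℕ
    walk     : Walk G u v len
    shortest : ∀ m → Walk G u v m → len ≤ m
open ShortestPath public

Visible : (G : Graph) → Subset (n G) → Fin (n G) → Fin (n G) → Set
Visible G X u v = Σ (ShortestPath G u v) λ P →
  ∀ i → vert (walk P) i ∈ X → (vert (walk P) i ≡ u) ⊎ (vert (walk P) i ≡ v)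

IsMutualVisibilitySet : (G : Graph) → Subset (n G) → Set
IsMutualVisibilitySet G X = ∀ u v → u ∈ X → v ∈ X → Visible G X u v

-- "The number of elements of Subset m satisfying P is c":
-- a duplicate-free list enumerating exactly the subsets satisfying P, of length c.
CountIs : {m : ℕ} → (Subset m → Set) → ℕ → Set
CountIs {m} P c = Σ (List (Subset m)) λ L →
  length L ≡ c × Unique L × (∀ X → (X LMem.∈ L) ⇔ P X)

-- r is the coefficient sequence of the visibility polynomial of G:
-- r i = number of mutual-visibility sets of G of cardinality i.
IsVisibilityPolynomial : (G : Graph) → (ℕ → ℕ) → Set
IsVisibilityPolynomial G r =
  ∀ i → CountIs (λ X → IsMutualVisibilitySet G X × ∣ X ∣ ≡ i) (r i)

Monic : (ℕ → ℕ) → Set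
Monic r = Σ ℕ λ d → r d ≡ 1 × (∀ j → d < j → r j ≡ 0)

-- Corona G ⊙ H. Vertices: Fin (n G + n G * n H); the first n G vertices are
-- the copy of G, the vertex encoded by quotRem giving (h , g) is vertex h of H_g.
coronaAdj : (G H : Graph) → Fin (n G + n G * n H) → Fin (n G + n G * n H) → Bool
coronaAdj G H a b with splitAt (n G) a | splitAt (n G) b
... | inj₁ x | inj₁ y = adj G x y
... | inj₁ x | inj₂ q with quotRem {n G} (n H) q
...   | (h , g) = ⌊ x ≟ g ⌋
coronaAdj G H a b | inj₂ q | inj₁ y with quotRem {n G} (n H) q
...   | (h , g) = ⌊ g ≟ y ⌋
coronaAdj G H a b | inj₂ q | inj₂ q' with quotRem {n G} (n H) q | quotRem {n G} (n H) q'
...   | (h , g) | (h' , g') = ⌊ g ≟ g' ⌋ ∧ adj H h h'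

_⊙_ : Graph → Graph → Graph
G ⊙ H = record { n = n G + n G * n H ; adj = coronaAdj G H }

{-# OPTIONS --safe #-}
-- Every vertex of a copy H_g meets the rest of G ⊙ H only through its root g, and a walk
-- between different fibers {g} ∪ H_g projects onto a walk of G; so vertices of H_a and H_b
-- (a ≠ b) are at distance d_G(a, b) + 2, realised by a geodesic whose interior consists of
-- roots only. Hence the union of all copies of H, of size |G||H|, is a mutual-visibility set.
-- It is the only one of that size: if a mutual-visibility set X contains a root a together
-- with a vertex of H_a, then X lies in the fiber of a, since a geodesic leaving that fiber
-- passes through a; if no root of X has a vertex of its own copy in X, sending every root g
-- to a fixed vertex of H_g is injective on X and misses a vertex of H_a. Either way X injects into the
-- union of the copies minus one vertex, and a rootless X is contained in that union.
-- Mutual visibility is decidable (a geodesic has length the distance, found by bounded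
-- search), which yields the coefficients of the polynomial.
module Submission where

open import Defs
open import Data.Nat using (ℕ; zero; suc; _+_; _*_; _≤_; _<_; z≤n; s≤s)
import Data.Nat as ℕ
open import Data.Nat.Induction using (<-rec)
open import Data.Nat.Properties
  using (anyUpTo?; ≮⇒≥; <⇒≱; <⇒≢; <⇒≤; ≤-refl; ≤-antisym; ≤-reflexive; ≤-trans; +-mono-≤; +-monoˡ-≤; m≤n+m)
open import Data.Bool using (true; false; _∧_)
open import Data.Fin
  using (Fin; zero; suc; inject₁; punchIn; _↑ˡ_; _↑ʳ_; splitAt; combine; quotRem; remQuot)
open import Data.Fin.Properties
  using ( any?; all?; _≟_; suc-injective; punchInᵢ≢i; splitAt-↑ˡ; splitAt-↑ʳ; splitAt⁻¹-↑ˡ; splitAt⁻¹-↑ʳ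
        ; remQuot-combine; combine-remQuot; ↑ʳ-injective; combine-injective)
open import Data.Fin.Subset using (Subset; inside; outside; _∈_; _∉_; _⊆_; _-_; ⊥; ⊤; ∣_∣)
open import Data.Fin.Subset.Properties
  using (_∈?_; ∈⊤; ∣⊤∣≡n; x∈p∧x≢y⇒x∈p-y; x∈p⇒∣p-x∣<∣p∣; p⊂q⇒∣p∣<∣q∣; ⊆-antisym)
import Data.Bool.Properties as Bool
open import Data.Vec using ([]; _∷_; here; there)
import Data.Vec as Vec
open import Data.Vec.Properties using (∷-injectiveʳ)
open import Data.List using (List; []; _∷_; [_]; length; map; _++_; filter)
import Data.List.Relation.Unary.All as All
open import Data.List.Relation.Unary.AllPairs using ([]; _∷_)
open import Data.List.Relation.Unary.Any using (here; there)
open import Data.List.Relation.Unary.Unique.Propositional using (Unique)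
import Data.List.Relation.Unary.Unique.Propositional.Properties as Unique
import Data.List.Membership.Propositional as List
open import Data.List.Membership.Propositional.Properties
  using (∈-map⁺; ∈-map⁻; ∈-++⁺ˡ; ∈-++⁺ʳ; ∈-filter⁺; ∈-filter⁻)
open import Data.Product using (Σ; _×_; _,_; proj₁; proj₂; ∃; swap; uncurry)
open import Data.Sum using (_⊎_; inj₁; inj₂; [_,_]′)
import Data.Sum as Sum
open import Data.Unit using (tt) renaming (⊤ to Unit)
open import Data.Empty using (⊥-elim)
open import Function using (_∘_; id; const; case_of_)
open import Function.Bundles using (mk⇔; Equivalence)
open import Relation.Binary.PropositionalEquality
  using (_≡_; _≢_; refl; sym; trans; cong; subst; ≡-≟-identity)
open import Relation.Nullary using (Dec; yes; no; ¬_)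
open import Relation.Nullary.Decidable using (⌊_⌋; toWitness; map′; _×-dec_; _⊎-dec_; _→-dec_)
open import Relation.Unary using (Decidable)

subsets : ∀ m → List (Subset m)
subsets zero    = [ [] ]
subsets (suc m) = map (inside ∷_) (subsets m) ++ map (outside ∷_) (subsets m)

∈-subsets : ∀ {m} (X : Subset m) → X List.∈ subsets m
∈-subsets []            = here refl
∈-subsets (inside ∷ X)  = ∈-++⁺ˡ (∈-map⁺ (inside ∷_) (∈-subsets X))
∈-subsets (outside ∷ X) = ∈-++⁺ʳ _ (∈-map⁺ (outside ∷_) (∈-subsets X))

subsets-unique : ∀ m → Unique (subsets m)
subsets-unique zero    = All.[] ∷ []
subsets-unique (suc m) =
  Unique.++⁺ (Unique.map⁺ ∷-injectiveʳ (subsets-unique m))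
             (Unique.map⁺ ∷-injectiveʳ (subsets-unique m))
             heads-differ
  where
  heads-differ : ∀ {X} → ¬ (X List.∈ map (inside ∷_) (subsets m) ×
                            X List.∈ map (outside ∷_) (subsets m))
  heads-differ (X∈ , X∈′) with ∈-map⁻ (inside ∷_) X∈ | ∈-map⁻ (outside ∷_) X∈′
  ... | _ , _ , refl | _ , _ , ()

count : ∀ {m} {P : Subset m → Set} → Decidable P → ∃ (CountIs P)
count {m} P? =
  length L , L , refl , Unique.filter⁺ P? (subsets-unique m) ,
  λ X → mk⇔ (proj₂ ∘ ∈-filter⁻ P? {xs = subsets m}) (∈-filter⁺ P? (∈-subsets X))
  where L = filter P? (subsets m)

CountIs-none : ∀ {m} {P : Subset m → Set} {c} → CountIs P c → (∀ X → ¬ P X) → c ≡ 0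
CountIs-none ([]    , refl , _) _    = refl
CountIs-none (X ∷ _ , refl , _ , L⇔P) none = ⊥-elim (none X (Equivalence.to (L⇔P X) (here refl)))

CountIs-unique : ∀ {m} {P : Subset m → Set} {c} X₀ → CountIs P c → P X₀ → (∀ X → P X → X ≡ X₀) →
                 c ≡ 1
CountIs-unique X₀ ([] , refl , _ , L⇔P) P₀ _ with () ← Equivalence.from (L⇔P X₀) P₀
CountIs-unique X₀ (X ∷ [] , refl , _) _ _ = refl
CountIs-unique X₀ (X ∷ Y ∷ _ , refl , (X∉ ∷ _) , L⇔P) _ only-X₀ =
  ⊥-elim (All.head X∉ (trans (only-X₀ X (P-at (here refl))) (sym (only-X₀ Y (P-at (there (here refl)))))))
  where
  P-at = λ {Z} → Equivalence.to (L⇔P Z)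

↑ˡ∉⊥++ : ∀ {m k} (i : Fin m) {q : Subset k} → i ↑ˡ k ∉ ⊥ Vec.++ q
↑ˡ∉⊥++ (suc i) (there i∈) = ↑ˡ∉⊥++ i i∈

↑ʳ∈++⊤ : ∀ {m k} (p : Subset m) (j : Fin k) → m ↑ʳ j ∈ p Vec.++ ⊤
↑ʳ∈++⊤ []      j = ∈⊤
↑ʳ∈++⊤ (_ ∷ p) j = there (↑ʳ∈++⊤ p j)

∣⊥++p∣≡∣p∣ : ∀ m {k} (p : Subset k) → ∣ ⊥ {m} Vec.++ p ∣ ≡ ∣ p ∣
∣⊥++p∣≡∣p∣ zero    p = refl
∣⊥++p∣≡∣p∣ (suc m) p = ∣⊥++p∣≡∣p∣ m p

InjectiveOn : ∀ {m k} → Subset m → (Fin m → Fin k) → Set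
InjectiveOn p f = ∀ {i j} → i ∈ p → j ∈ p → f i ≡ f j → i ≡ j

injection⇒∣p∣≤∣q∣ : ∀ {m k} {p : Subset m} {q : Subset k} (f : Fin m → Fin k) →
                   (∀ {i} → i ∈ p → f i ∈ q) → InjectiveOn p f → ∣ p ∣ ≤ ∣ q ∣
injection⇒∣p∣≤∣q∣ {p = []}          f into injective = z≤n
injection⇒∣p∣≤∣q∣ {p = outside ∷ p} f into injective =
  injection⇒∣p∣≤∣q∣ (f ∘ suc) (into ∘ there) (λ i∈ j∈ → suc-injective ∘ injective (there i∈) (there j∈))
injection⇒∣p∣≤∣q∣ {p = inside ∷ p}  f into injective =
  ≤-trans (s≤s (injection⇒∣p∣≤∣q∣ (f ∘ suc) into-rest injective-rest)) (x∈p⇒∣p-x∣<∣p∣ (into here))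
  where
  into-rest : ∀ {i} → i ∈ p → f (suc i) ∈ _ - f zero
  into-rest i∈ = x∈p∧x≢y⇒x∈p-y (into (there i∈)) (λ e → case injective (there i∈) here e of λ ())
  injective-rest : InjectiveOn p (f ∘ suc)
  injective-rest i∈ j∈ = suc-injective ∘ injective (there i∈) (there j∈)

injection-missing⇒∣p∣<∣q∣ : ∀ {m k} {p : Subset m} {q : Subset k} {x} (f : Fin m → Fin k) → x ∈ q →
                           (∀ {i} → i ∈ p → f i ∈ q) → (∀ {i} → i ∈ p → f i ≢ x) → InjectiveOn p f →
                           ∣ p ∣ < ∣ q ∣
injection-missing⇒∣p∣<∣q∣ f x∈q into misses injective =
  ≤-trans (s≤s (injection⇒∣p∣≤∣q∣ f (λ i∈ → x∈p∧x≢y⇒x∈p-y (into i∈) (misses i∈)) injective))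
          (x∈p⇒∣p-x∣<∣p∣ x∈q)

two-distinct : ∀ {m} → 2 ≤ m → ∃ λ (x : Fin m) → ∃ λ y → x ≢ y
two-distinct {suc (suc _)} _         = zero , suc zero , λ ()
two-distinct {suc zero}    (s≤s ())

another : ∀ {m} → 2 ≤ m → (x : Fin m) → ∃ λ y → y ≢ x
another {suc (suc _)} _ x         = punchIn x zero , punchInᵢ≢i x zero
another {suc zero}    (s≤s ()) _

Least : (ℕ → Set) → ℕ → Set
Least Q d = Q d × (∀ {m} → m < d → ¬ Q m)

least : ∀ {Q : ℕ → Set} → Decidable Q → ∀ {k} → Q k → ∃ (Least Q)
least {Q} Q? {k} = <-rec (λ k → Q k → ∃ (Least Q)) search k
  where
  search : ∀ k → (∀ {j} → j < k → Q j → ∃ (Least Q)) → Q k → ∃ (Least Q)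
  search k below Qk with anyUpTo? Q? k
  ... | yes (j , j<k , Qj) = below j<k Qj
  ... | no none            = k , Qk , λ m<k Qm → none (_ , m<k , Qm)

module _ (G : Graph) where

  private
    V = Fin (n G)

  WalkWithin : (V → Set) → ℕ → V → V → Set
  WalkWithin P zero    u v = P u × u ≡ v
  WalkWithin P (suc k) u v = P u × ∃ λ w → adj G u w ≡ true × WalkWithin P k w v

  Reach : ℕ → V → V → Set
  Reach = WalkWithin (λ _ → Unit)

  walkWithin? : ∀ {P} → Decidable P → ∀ k u v → Dec (WalkWithin P k u v)
  walkWithin? P? zero    u v = P? u ×-dec u ≟ v
  walkWithin? P? (suc k) u v = P? u ×-dec any? (λ w → adj G u w Bool.≟ true ×-dec walkWithin? P? k w v)

  WalkWithin-head : ∀ {P} k {u v} → WalkWithin P k u v → P u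
  WalkWithin-head zero    (Pu , _) = Pu
  WalkWithin-head (suc k) (Pu , _) = Pu

  WalkWithin⇒Reach : ∀ {P} k {u v} → WalkWithin P k u v → Reach k u v
  WalkWithin⇒Reach zero    (_ , u≡v)        = tt , u≡v
  WalkWithin⇒Reach (suc k) (_ , w , uw , W) = tt , w , uw , WalkWithin⇒Reach k W

  WalkWithin-++ : ∀ {P} k {l u w v} → WalkWithin P k u w → WalkWithin P l w v → WalkWithin P (k + l) u v
  WalkWithin-++ zero    (_ , refl)        W′ = W′
  WalkWithin-++ (suc k) (Pu , x , ux , W) W′ = Pu , x , ux , WalkWithin-++ k W W′

  WalkWithin⇒Walk : ∀ {P} k {u v} → WalkWithin P k u v → Σ (Walk G u v k) λ W → ∀ i → P (vert W i)
  WalkWithin⇒Walk zero {u} (Pu , refl) =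
    record { vert = λ _ → u ; start = refl ; end = refl ; step = λ () } , λ { zero → Pu }
  WalkWithin⇒Walk {P} (suc k) {u} (Pu , w , uw , W) with WalkWithin⇒Walk k W
  ... | W′ , PW′ = record { vert = vert′ ; start = refl ; end = end W′ ; step = step′ } , Pvert′
    where
    vert′ : Fin (suc (suc k)) → V
    vert′ zero    = u
    vert′ (suc i) = vert W′ i
    step′ : ∀ i → adj G (vert′ (inject₁ i)) (vert′ (suc i)) ≡ true
    step′ zero    = subst (λ x → adj G u x ≡ true) (sym (start W′)) uw
    step′ (suc i) = step W′ i
    Pvert′ : ∀ i → P (vert′ i)
    Pvert′ zero    = Pu
    Pvert′ (suc i) = PW′ i

  Walk⇒WalkWithin : ∀ {P} k {u v} (W : Walk G u v k) → (∀ i → P (vert W i)) → WalkWithin P k u v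
  Walk⇒WalkWithin {P} zero    W PW = subst P (start W) (PW zero) , trans (sym (start W)) (end W)
  Walk⇒WalkWithin {P} (suc k) W PW =
    subst P (start W) (PW zero) , vert W (suc zero) ,
    subst (λ x → adj G x (vert W (suc zero)) ≡ true) (start W) (step W zero) ,
    Walk⇒WalkWithin k tail (PW ∘ suc)
    where
    tail : Walk G (vert W (suc zero)) _ k
    tail = record { vert = vert W ∘ suc ; start = refl ; end = end W ; step = step W ∘ suc }

  Walk⇒Reach : ∀ k {u v} → Walk G u v k → Reach k u v
  Walk⇒Reach k W = Walk⇒WalkWithin k W (λ _ → tt)

  NoShorter : ℕ → V → V → Set
  NoShorter k u v = ∀ {m} → m < k → ¬ Reach m u v

  NoShorter⇒≤ : ∀ {k m u v} → NoShorter k u v → Reach m u v → k ≤ m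
  NoShorter⇒≤ noShorter r = ≮⇒≥ (λ m<k → noShorter m<k r)

  distance : Connected G → ∀ u v → ∃ λ d → Reach d u v × NoShorter d u v
  distance conn u v with conn u v
  ... | k , W = least (λ m → walkWithin? (λ _ → yes tt) m u v) (Walk⇒Reach k W)

  Avoids : Subset (n G) → V → V → V → Set
  Avoids X u v x = x ∈ X → x ≡ u ⊎ x ≡ v

  visible : ∀ {X u v} k → WalkWithin (Avoids X u v) k u v → NoShorter k u v → Visible G X u v
  visible k W noShorter with WalkWithin⇒Walk k W
  ... | W′ , avoids =
    record { len = k ; walk = W′ ; shortest = λ m W″ → NoShorter⇒≤ noShorter (Walk⇒Reach m W″) } , avoids

  visible⁻ : ∀ {X u v} → Visible G X u v → ∃ λ k → WalkWithin (Avoids X u v) k u v × NoShorter k u v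
  visible⁻ (P , avoids) =
    len P , Walk⇒WalkWithin (len P) (walk P) avoids ,
    λ {m} m<k r → <⇒≱ m<k (shortest P m (proj₁ (WalkWithin⇒Walk m r)))

  visible? : Connected G → ∀ X u v → Dec (Visible G X u v)
  visible? conn X u v with distance conn u v
  ... | d , Rd , noShorter = map′ (λ W → visible d W noShorter) at-distance (walkWithin? avoids? d u v)
    where
    avoids? : Decidable (Avoids X u v)
    avoids? x = x ∈? X →-dec (x ≟ u ⊎-dec x ≟ v)
    at-distance : Visible G X u v → WalkWithin (Avoids X u v) d u v
    at-distance vis with visible⁻ vis
    ... | k , W , noShorterₖ =
      subst (λ j → WalkWithin (Avoids X u v) j u v)
            (≤-antisym (NoShorter⇒≤ noShorterₖ Rd) (NoShorter⇒≤ noShorter (WalkWithin⇒Reach k W))) W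

  mutualVisibility? : Connected G → Decidable (IsMutualVisibilitySet G)
  mutualVisibility? conn X = all? λ u → all? λ v → u ∈? X →-dec (v ∈? X →-dec visible? conn X u v)

module Corona (G H : Graph) where

  private
    V = Fin (n (G ⊙ H))

  gv : Fin (n G) → V
  gv g = g ↑ˡ (n G * n H)

  hv : Fin (n H) → Fin (n G) → V
  hv h g = n G ↑ʳ combine g h

  private
    splitAt-gv : ∀ g → splitAt (n G) (gv g) ≡ inj₁ g
    splitAt-gv g = splitAt-↑ˡ (n G) g (n G * n H)

    splitAt-hv : ∀ h g → splitAt (n G) (hv h g) ≡ inj₂ (combine g h)
    splitAt-hv h g = splitAt-↑ʳ (n G) (n G * n H) (combine g h)

    quotRem-combine : ∀ g h → quotRem {n G} (n H) (combine g h) ≡ (h , g)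
    quotRem-combine g h = cong swap (remQuot-combine g h)

  adj-gv-gv : ∀ x y → adj (G ⊙ H) (gv x) (gv y) ≡ adj G x y
  adj-gv-gv x y rewrite splitAt-gv x | splitAt-gv y = refl

  adj-gv-hv : ∀ x h g → adj (G ⊙ H) (gv x) (hv h g) ≡ ⌊ x ≟ g ⌋
  adj-gv-hv x h g rewrite splitAt-gv x | splitAt-hv h g | quotRem-combine g h = refl

  adj-hv-gv : ∀ h g y → adj (G ⊙ H) (hv h g) (gv y) ≡ ⌊ g ≟ y ⌋
  adj-hv-gv h g y rewrite splitAt-gv y | splitAt-hv h g | quotRem-combine g h = refl

  adj-hv-hv : ∀ h g h′ g′ → adj (G ⊙ H) (hv h g) (hv h′ g′) ≡ ⌊ g ≟ g′ ⌋ ∧ adj H h h′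
  adj-hv-hv h g h′ g′
    rewrite splitAt-hv h g | splitAt-hv h′ g′ | quotRem-combine g h | quotRem-combine g′ h′ = refl

  data View : V → Set where
    gv-view : ∀ g → View (gv g)
    hv-view : ∀ h g → View (hv h g)

  view : ∀ a → View a
  view a with splitAt (n G) a in split
  ... | inj₁ g = subst View (splitAt⁻¹-↑ˡ split) (gv-view g)
  ... | inj₂ q = subst View (trans (cong (n G ↑ʳ_) (combine-remQuot {n G} (n H) q)) (splitAt⁻¹-↑ʳ split))
                        (hv-view (proj₂ (remQuot {n G} (n H) q)) (proj₁ (remQuot {n G} (n H) q)))

  hv-injective : ∀ {h g h′ g′} → hv h g ≡ hv h′ g′ → h ≡ h′ × g ≡ g′
  hv-injective e = swap (combine-injective _ _ _ _ (↑ʳ-injective _ _ _ e))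

  gv≢hv : ∀ {g h g′} → gv g ≢ hv h g′
  gv≢hv {g} {h} {g′} e
    with () ← trans (sym (splitAt-gv g)) (trans (cong (splitAt (n G)) e) (splitAt-hv h g′))

  private
    decode : V → Fin (n G) ⊎ (Fin (n H) × Fin (n G))
    decode a = Sum.map₂ (quotRem (n H)) (splitAt (n G) a)

    decode-gv : ∀ g → decode (gv g) ≡ inj₁ g
    decode-gv g rewrite splitAt-gv g = refl

    decode-hv : ∀ h g → decode (hv h g) ≡ inj₂ (h , g)
    decode-hv h g rewrite splitAt-hv h g | quotRem-combine g h = refl

  fiber : V → Fin (n G)
  fiber = [ id , proj₂ ]′ ∘ decode

  depth : V → ℕ
  depth = [ const 0 , const 1 ]′ ∘ decode

  fiber-gv : ∀ g → fiber (gv g) ≡ g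
  fiber-gv g rewrite decode-gv g = refl

  fiber-hv : ∀ h g → fiber (hv h g) ≡ g
  fiber-hv h g rewrite decode-hv h g = refl

  depth-gv : ∀ g → depth (gv g) ≡ 0
  depth-gv g rewrite decode-gv g = refl

  depth-hv : ∀ h g → depth (hv h g) ≡ 1
  depth-hv h g rewrite decode-hv h g = refl

  descend : Fin (n H) → V → V
  descend h₀ = [ hv h₀ , uncurry hv ]′ ∘ decode

  descend-gv : ∀ h₀ g → descend h₀ (gv g) ≡ hv h₀ g
  descend-gv h₀ g rewrite decode-gv g = refl

  descend-hv : ∀ h₀ h g → descend h₀ (hv h g) ≡ hv h g
  descend-hv h₀ h g rewrite decode-hv h g = refl

  private
    ≟-sound : ∀ {x y : Fin (n G)} → ⌊ x ≟ y ⌋ ≡ true → x ≡ y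
    ≟-sound = toWitness ∘ Equivalence.from Bool.T-≡

    ≟-refl : ∀ (x : Fin (n G)) → ⌊ x ≟ x ⌋ ≡ true
    ≟-refl x = cong ⌊_⌋ (≡-≟-identity _≟_ {x} refl)

  gv-adj-hv : ∀ h g → adj (G ⊙ H) (gv g) (hv h g) ≡ true
  gv-adj-hv h g = trans (adj-gv-hv g h g) (≟-refl g)

  hv-adj-gv : ∀ h g → adj (G ⊙ H) (hv h g) (gv g) ≡ true
  hv-adj-gv h g = trans (adj-hv-gv h g g) (≟-refl g)

  hv-neighbour : ∀ {h g w} → adj (G ⊙ H) (hv h g) w ≡ true → w ≡ gv g ⊎ ∃ λ h′ → w ≡ hv h′ g
  hv-neighbour {h} {g} {w} hw with view w
  ... | gv-view y    = inj₁ (cong gv (sym (≟-sound (trans (sym (adj-hv-gv h g y)) hw))))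
  ... | hv-view h′ g′ =
    inj₂ (h′ , cong (hv h′) (sym (≟-sound (Bool.∧-conicalˡ _ _ (trans (sym (adj-hv-hv h g h′ g′)) hw)))))

  crossing-edge : ∀ {x w} → adj (G ⊙ H) x w ≡ true → fiber x ≢ fiber w →
                  ∃ λ a → ∃ λ b → x ≡ gv a × w ≡ gv b × adj G a b ≡ true
  crossing-edge {x} {w} xw x≁w with view x | view w
  ... | gv-view a | gv-view b = a , b , refl , refl , trans (sym (adj-gv-gv a b)) xw
  ... | gv-view a | hv-view h g =
    ⊥-elim (x≁w (trans (fiber-gv a) (trans (≟-sound (trans (sym (adj-gv-hv a h g)) xw)) (sym (fiber-hv h g)))))
  ... | hv-view h g | _ with hv-neighbour xw
  ...   | inj₁ refl        = ⊥-elim (x≁w (trans (fiber-hv h g) (sym (fiber-gv g))))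
  ...   | inj₂ (h′ , refl) = ⊥-elim (x≁w (trans (fiber-hv h g) (sym (fiber-hv h′ g))))

  lift : ∀ {P} → (∀ a → P (gv a)) → ∀ k {a b} → Reach G k a b →
         WalkWithin (G ⊙ H) P k (gv a) (gv b)
  lift P-gv zero    {a} (_ , refl)       = P-gv a , refl
  lift P-gv (suc k) {a} (_ , w , aw , W) = P-gv a , gv w , trans (adj-gv-gv a w) aw , lift P-gv k W

  to-root : ∀ u → ∃ λ k → Reach (G ⊙ H) k u (gv (fiber u))
  to-root u with view u
  ... | gv-view g                       = 0 , tt , cong gv (sym (fiber-gv g))
  ... | hv-view h g rewrite fiber-hv h g = 1 , tt , gv g , hv-adj-gv h g , tt , refl

  from-root : ∀ v → ∃ λ k → Reach (G ⊙ H) k (gv (fiber v)) v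
  from-root v with view v
  ... | gv-view g                       = 0 , tt , cong gv (fiber-gv g)
  ... | hv-view h g rewrite fiber-hv h g = 1 , tt , hv h g , gv-adj-hv h g , tt , refl

  connected : Connected G → Connected (G ⊙ H)
  connected conn u v with to-root u | conn (fiber u) (fiber v) | from-root v
  ... | k₁ , R₁ | k , W | k₂ , R₂ =
    k₁ + (k + k₂) ,
    proj₁ (WalkWithin⇒Walk _ _
      (WalkWithin-++ _ k₁ R₁ (WalkWithin-++ _ k (lift (λ _ → tt) k (Walk⇒Reach G k W)) R₂)))

  leaving-fiber-visits-root : ∀ {P} m {h a y} → fiber y ≢ a → WalkWithin (G ⊙ H) P m (hv h a) y →
                              P (gv a)
  leaving-fiber-visits-root zero    {h} {a} y≁a (_ , refl) = ⊥-elim (y≁a (fiber-hv h a))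
  leaving-fiber-visits-root (suc m)           y≁a (_ , w , hw , W) with hv-neighbour hw
  ... | inj₁ refl        = WalkWithin-head _ m W
  ... | inj₂ (h′ , refl) = leaving-fiber-visits-root m y≁a W

  depth≤1 : ∀ x → depth x ≤ 1
  depth≤1 x with view x
  ... | gv-view g   rewrite depth-gv g   = z≤n
  ... | hv-view h g rewrite depth-hv h g = s≤s z≤n

  project : ∀ m {x y} → fiber x ≢ fiber y → Reach (G ⊙ H) m x y →
            ∃ λ k → Reach G k (fiber x) (fiber y) × depth x + (k + depth y) ≤ m
  project zero x≁y (_ , refl) = ⊥-elim (x≁y refl)
  project (suc m) {x} {y} x≁y (_ , w , xw , W) with fiber w ≟ fiber y
  ... | yes w~y with crossing-edge xw (x≁y ∘ (λ x~w → trans x~w w~y))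
  ...   | a , b , refl , refl , ab rewrite fiber-gv a | depth-gv a =
          1 , (tt , b , ab , tt , trans (sym (fiber-gv b)) w~y) , s≤s (depth-after m W)
    where
    depth-after : ∀ m → Reach (G ⊙ H) m (gv b) y → depth y ≤ m
    depth-after zero    (_ , refl) = ≤-reflexive (depth-gv b)
    depth-after (suc m) _          = ≤-trans (depth≤1 y) (s≤s z≤n)
  project (suc m) {x} {y} x≁y (_ , w , xw , W) | no w≁y with project m w≁y W
  ... | k , Rk , bound with fiber x ≟ fiber w
  ...   | yes x~w = k , subst (λ z → Reach G k z (fiber y)) (sym x~w) Rk ,
                    +-mono-≤ (depth≤1 x) (≤-trans (m≤n+m _ (depth w)) bound)
  ...   | no x≁w with crossing-edge xw x≁w
  ...     | a , b , refl , refl , ab rewrite fiber-gv a | depth-gv a | fiber-gv b | depth-gv b =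
            suc k , (tt , b , ab , Rk) , s≤s bound

  module _ {X : Subset (n (G ⊙ H))} (gv∉X : ∀ g → gv g ∉ X) where

    private
      avoids-gv : ∀ {u v} g → Avoids (G ⊙ H) X u v (gv g)
      avoids-gv g gv∈X = ⊥-elim (gv∉X g gv∈X)

    fiber-visible : ∀ h h′ a → Visible (G ⊙ H) X (hv h a) (hv h′ a)
    fiber-visible h h′ a with hv h a ≟ hv h′ a
    ... | yes same = visible _ 0 ((λ _ → inj₁ refl) , same) (λ ())
    ... | no distinct with adj (G ⊙ H) (hv h a) (hv h′ a) in adjacent
    ...   | true  = visible _ 1 ((λ _ → inj₁ refl) , hv h′ a , adjacent , (λ _ → inj₂ refl) , refl)
                      λ { (s≤s z≤n) (_ , same) → distinct same }
    ...   | false = visible _ 2 ((λ _ → inj₁ refl) , gv a , hv-adj-gv h a , avoids-gv a ,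
                                 hv h′ a , gv-adj-hv h′ a , (λ _ → inj₂ refl) , refl)
                      λ { (s≤s z≤n) (_ , same) → distinct same
                        ; (s≤s (s≤s z≤n)) (_ , w , hw , _ , refl) → case trans (sym hw) adjacent of λ () }

    crossing-visible : Connected G → ∀ h h′ {a b} → a ≢ b → Visible (G ⊙ H) X (hv h a) (hv h′ b)
    crossing-visible conn h h′ {a} {b} a≢b with distance G conn a b
    ... | d , Rd , noShorter =
      visible _ (suc (d + 1))
        ((λ _ → inj₁ refl) , gv a , hv-adj-gv h a ,
         WalkWithin-++ _ d (lift avoids-gv d Rd)
           (avoids-gv b , hv h′ b , gv-adj-hv h′ b , (λ _ → inj₂ refl) , refl))
        no-shorter
      where
      no-shorter : NoShorter (G ⊙ H) (suc (d + 1)) (hv h a) (hv h′ b)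
      no-shorter {m} m<d+2 R
        with project m (λ a~b → a≢b (trans (sym (fiber-hv h a)) (trans a~b (fiber-hv h′ b)))) R
      ... | k , Rk , bound rewrite fiber-hv h a | fiber-hv h′ b | depth-hv h a | depth-hv h′ b =
        <⇒≱ m<d+2 (≤-trans (s≤s (+-monoˡ-≤ 1 (NoShorter⇒≤ G noShorter Rk))) bound)

  H-copies : Subset (n (G ⊙ H))
  H-copies = ⊥ {n G} Vec.++ ⊤

  gv∉H-copies : ∀ g → gv g ∉ H-copies
  gv∉H-copies g = ↑ˡ∉⊥++ g

  hv∈H-copies : ∀ h g → hv h g ∈ H-copies
  hv∈H-copies h g = ↑ʳ∈++⊤ ⊥ (combine g h)

  ∣H-copies∣ : ∣ H-copies ∣ ≡ n G * n H
  ∣H-copies∣ = trans (∣⊥++p∣≡∣p∣ (n G) ⊤) (∣⊤∣≡n (n G * n H))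

  H-copies-mutualVisibility : Connected G → IsMutualVisibilitySet (G ⊙ H) H-copies
  H-copies-mutualVisibility conn u v u∈ v∈ with view u | view v
  ... | gv-view g   | _           = ⊥-elim (gv∉H-copies g u∈)
  ... | hv-view _ _ | gv-view g   = ⊥-elim (gv∉H-copies g v∈)
  ... | hv-view h a | hv-view h′ b with a ≟ b
  ...   | yes refl = fiber-visible gv∉H-copies h h′ a
  ...   | no a≢b   = crossing-visible gv∉H-copies conn h h′ a≢b

  fiber-trapped : ∀ {X} → IsMutualVisibilitySet (G ⊙ H) X →
                  ∀ {a h y} → gv a ∈ X → hv h a ∈ X → y ∈ X → fiber y ≡ a
  fiber-trapped mv {a} {h} {y} ga∈ ha∈ y∈ with fiber y ≟ a
  ... | yes y~a = y~a
  ... | no y≁a with visible⁻ _ (mv _ _ ha∈ y∈)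
  ...   | k , W , _ with leaving-fiber-visits-root k y≁a W ga∈
  ...     | inj₁ ga≡ha = ⊥-elim (gv≢hv ga≡ha)
  ...     | inj₂ ga≡y  = ⊥-elim (y≁a (trans (cong fiber (sym ga≡y)) (fiber-gv a)))

  root-and-fiber-vertex⇒< : 2 ≤ n G → 2 ≤ n H → ∀ {X} → IsMutualVisibilitySet (G ⊙ H) X →
                            ∀ {a h} → gv a ∈ X → hv h a ∈ X → ∣ X ∣ < ∣ H-copies ∣
  root-and-fiber-vertex⇒< 2≤G 2≤H {X} mv {a} {h} ga∈ ha∈ =
    injection-missing⇒∣p∣<∣q∣ f (hv∈H-copies h′ b) into misses injective
    where
    b = proj₁ (another 2≤G a)
    h′ = proj₁ (another 2≤H h)
    in-fiber-a : ∀ {y} → y ∈ X → fiber y ≡ a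
    in-fiber-a = fiber-trapped mv ga∈ ha∈
    b∉fiber-a : ∀ {y} → y ∈ X → fiber y ≢ b
    b∉fiber-a y∈ y~b = proj₂ (another 2≤G a) (trans (sym y~b) (in-fiber-a y∈))
    f : V → V
    f y with y ≟ gv a
    ... | yes _ = hv h b
    ... | no _  = y
    into : ∀ {y} → y ∈ X → f y ∈ H-copies
    into {y} y∈ with y ≟ gv a | view y
    ... | yes _  | _           = hv∈H-copies h b
    ... | no y≢a | gv-view g   = ⊥-elim (y≢a (cong gv (trans (sym (fiber-gv g)) (in-fiber-a y∈))))
    ... | no _   | hv-view h″ g = hv∈H-copies h″ g
    misses : ∀ {y} → y ∈ X → f y ≢ hv h′ b
    misses {y} y∈ with y ≟ gv a
    ... | yes _ = proj₂ (another 2≤H h) ∘ sym ∘ proj₁ ∘ hv-injective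
    ... | no _  = λ y≡ → b∉fiber-a y∈ (trans (cong fiber y≡) (fiber-hv h′ b))
    injective : InjectiveOn X f
    injective {y} {z} y∈ z∈ fy≡fz with y ≟ gv a | z ≟ gv a
    ... | yes y≡a | yes z≡a = trans y≡a (sym z≡a)
    ... | yes _   | no _    = ⊥-elim (b∉fiber-a z∈ (trans (cong fiber (sym fy≡fz)) (fiber-hv h b)))
    ... | no _    | yes _   = ⊥-elim (b∉fiber-a y∈ (trans (cong fiber fy≡fz) (fiber-hv h b)))
    ... | no _    | no _    = fy≡fz

  root-without-fiber-vertex⇒< : 2 ≤ n H → ∀ {X a} → gv a ∈ X → (∀ {g h} → gv g ∈ X → hv h g ∉ X) →
                                ∣ X ∣ < ∣ H-copies ∣
  root-without-fiber-vertex⇒< 2≤H {X} {a} ga∈ no-fiber-vertex =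
    injection-missing⇒∣p∣<∣q∣ (descend h₀) (hv∈H-copies h₁ a) into misses injective
    where
    h₀ = proj₁ (two-distinct 2≤H)
    h₁ = proj₁ (proj₂ (two-distinct 2≤H))
    h₀≢h₁ = proj₂ (proj₂ (two-distinct 2≤H))
    into : ∀ {y} → y ∈ X → descend h₀ y ∈ H-copies
    into {y} _ with view y
    ... | gv-view g   = subst (_∈ H-copies) (sym (descend-gv h₀ g)) (hv∈H-copies h₀ g)
    ... | hv-view h g = subst (_∈ H-copies) (sym (descend-hv h₀ h g)) (hv∈H-copies h g)
    misses : ∀ {y} → y ∈ X → descend h₀ y ≢ hv h₁ a
    misses {y} y∈ with view y
    ... | gv-view g   = λ e → h₀≢h₁ (proj₁ (hv-injective (trans (sym (descend-gv h₀ g)) e)))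
    ... | hv-view h g = λ e → no-fiber-vertex ga∈ (subst (_∈ X) (trans (sym (descend-hv h₀ h g)) e) y∈)
    injective : InjectiveOn X (descend h₀)
    injective {y} {z} y∈ z∈ e with view y | view z
    ... | gv-view g   | gv-view g′   = cong gv (proj₂ (hv-injective (trans (sym (descend-gv h₀ g)) hv≡)))
      where hv≡ = trans e (descend-gv h₀ g′)
    ... | gv-view g   | hv-view h g′ = ⊥-elim (no-fiber-vertex y∈ (subst (_∈ X) (sym hv≡) z∈))
      where hv≡ = trans (sym (descend-gv h₀ g)) (trans e (descend-hv h₀ h g′))
    ... | hv-view h g | gv-view g′   = ⊥-elim (no-fiber-vertex z∈ (subst (_∈ X) hv≡ y∈))
      where hv≡ = trans (sym (descend-hv h₀ h g)) (trans e (descend-gv h₀ g′))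
    ... | hv-view h g | hv-view h′ g′ = trans (sym (descend-hv h₀ h g)) (trans e (descend-hv h₀ h′ g′))

  root∈⇒< : 2 ≤ n G → 2 ≤ n H → ∀ {X} → IsMutualVisibilitySet (G ⊙ H) X → ∀ {a} → gv a ∈ X →
            ∣ X ∣ < ∣ H-copies ∣
  root∈⇒< 2≤G 2≤H {X} mv ga∈ with any? (λ g → gv g ∈? X ×-dec any? (λ h → hv h g ∈? X))
  ... | yes (_ , gg∈ , _ , hg∈) = root-and-fiber-vertex⇒< 2≤G 2≤H mv gg∈ hg∈
  ... | no ∄root-and-fiber-vertex =
    root-without-fiber-vertex⇒< 2≤H ga∈ λ gg∈ hg∈ → ∄root-and-fiber-vertex (_ , gg∈ , _ , hg∈)

  rootless⇒⊆H-copies : ∀ {X} → (∀ g → gv g ∉ X) → X ⊆ H-copies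
  rootless⇒⊆H-copies {X} gv∉X {y} y∈ with view y
  ... | gv-view g   = ⊥-elim (gv∉X g y∈)
  ... | hv-view h g = hv∈H-copies h g

  H-copies-unique : 2 ≤ n G → 2 ≤ n H → ∀ {X} → IsMutualVisibilitySet (G ⊙ H) X →
                    ∣ H-copies ∣ ≤ ∣ X ∣ → X ≡ H-copies
  H-copies-unique 2≤G 2≤H {X} mv large with any? (λ g → gv g ∈? X)
  ... | yes (_ , ga∈) = ⊥-elim (<⇒≱ (root∈⇒< 2≤G 2≤H mv ga∈) large)
  ... | no ∄root      = ⊆-antisym X⊆H-copies H-copies⊆X
    where
    X⊆H-copies : X ⊆ H-copies
    X⊆H-copies = rootless⇒⊆H-copies (λ g ga∈ → ∄root (g , ga∈))
    H-copies⊆X : H-copies ⊆ X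
    H-copies⊆X {y} y∈H with y ∈? X
    ... | yes y∈ = y∈
    ... | no y∉  = ⊥-elim (<⇒≱ (p⊂q⇒∣p∣<∣q∣ (X⊆H-copies , y , y∈H , y∉)) large)

mainTheorem9 : (G H : Graph) → IsSimple G → IsSimple H → Connected G → Connected H →
                   2 ≤ n G → 2 ≤ n H →
                   Σ (ℕ → ℕ) λ r → IsVisibilityPolynomial (G ⊙ H) r × Monic r
mainTheorem9 G H _ _ conn _ 2≤G 2≤H = r , counts-r , n G * n H , r-top , r-above
  where
  open Corona G H
  OfSize : ℕ → Subset (n (G ⊙ H)) → Set
  OfSize i X = IsMutualVisibilitySet (G ⊙ H) X × ∣ X ∣ ≡ i
  counts : ∀ i → ∃ (CountIs (OfSize i))
  counts i = count λ X → mutualVisibility? (G ⊙ H) (connected conn) X ×-dec ∣ X ∣ ℕ.≟ i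
  r : ℕ → ℕ
  r = proj₁ ∘ counts
  counts-r : IsVisibilityPolynomial (G ⊙ H) r
  counts-r = proj₂ ∘ counts
  maximum : ∀ {i X} → n G * n H ≤ i → OfSize i X → X ≡ H-copies
  maximum {X = X} large (mv , refl) = H-copies-unique 2≤G 2≤H mv (subst (_≤ ∣ X ∣) (sym ∣H-copies∣) large)
  r-top : r (n G * n H) ≡ 1
  r-top = CountIs-unique H-copies (counts-r _) (H-copies-mutualVisibility conn , ∣H-copies∣)
                         (λ X → maximum ≤-refl)
  r-above : ∀ j → n G * n H < j → r j ≡ 0
  r-above j above = CountIs-none (counts-r j) λ X X∈@(_ , ∣X∣≡j) →
    <⇒≢ above (trans (sym ∣H-copies∣) (trans (cong ∣_∣ (sym (maximum (<⇒≤ above) X∈))) ∣X∣≡j))
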